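{- Let $G$ be a finite simple graph with maximum degree $\Delta$, let $k$ be a positive integer, and let $S$ be a $K_k$-isolating set of $G$ of minimum cardinality $\iota_k(G)$, with $S\neq\emptyset$. Construct a sequence $v_1,v_2,\dots,v_\ell$ of vertices of $S$ as follows: put $S_0=S$; for $i\ge 1$, let $v_i$ be a vertex of minimum degree in the induced subgraph $G[S_{i-1}]$ and put $S_i=S_{i-1}\setminus N_G[v_i]$; stop at the first $\ell$ with $S_\ell=\emptyset$ (so that $S=\bigcup_{i=1}^{\ell}N_{S_{i-1}}[v_i]$). Then $$\iota'_k(G)\le -\frac{\iota_k(G)^2}{\ell}+\iota_k(G)(\Delta+2)-\ell\Delta .$$
   Context: For a graph $G$ and $v\in V(G)$, $N_G(v)$ is the set of neighbors of $v$, $N_G[v]=N_G(v)\cup\{v\}$; for $S\subseteq V(G)$, $N_G[S]=\bigcup_{v\in S}N_G[v]$ and $N_S[v]=N_G[v]\cap S$. $K_k$ denotes the complete graph on $k$ vertices. A set $S\subseteq V(G)$ is $K_k$-isolating if the graph $G-N_G[S]$ (obtained by deleting the vertices of $N_G[S]$) contains no subgraph isomorphic to $K_k$. The $K_k$-isolation number $\iota_k(G)$ is the minimum cardinality of a $K_k$-isolating set. A set is independent $K_k$-isolating if it is $K_k$-isolating and induces no edge; $\iota'_k(G)$ is the minimum cardinality of an independent $K_k$-isolating set. -}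

module Defs where

open import Data.Nat using (ℕ; _≤_; _⊔_)
open import Data.Bool using (Bool; true; false; _∧_; _∨_)
open import Data.Fin using (Fin)
open import Data.Fin.Subset using (Subset; _∈_; _∉_; ∣_∣; _─_; ⁅_⁆; Empty)
open import Data.List using (List; []; _∷_; allFin; foldr; map)
open import Data.Bool.ListAction using (any)
open import Data.Vec using (lookup; tabulate)
open import Data.Product using (Σ; _×_)
open import Relation.Binary.PropositionalEquality using (_≡_; _≢_)
open import Relation.Nullary using (¬_)
open import Function.Definitions using (Injective)

record Graph (n : ℕ) : Set where
  field
    adj   : Fin n → Fin n → Bool
    sym   : ∀ u v → adj u v ≡ adj v u
    irref : ∀ v → adj v v ≡ false
open Graph public

module _ {n : ℕ} (G : Graph n) where

  nbhd : Fin n → Subset n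
  nbhd v = tabulate (λ u → adj G v u)

  degree : Fin n → ℕ
  degree v = ∣ nbhd v ∣

  maxDegree : ℕ
  maxDegree = foldr _⊔_ 0 (map degree (allFin n))

  closedNbhd : Subset n → Subset n
  closedNbhd S = tabulate (λ u → lookup S u ∨ any (λ v → lookup S v ∧ adj G u v) (allFin n))

  hasCliqueOutside : ℕ → Subset n → Set
  hasCliqueOutside k S =
    Σ (Fin k → Fin n) λ f →
      Injective _≡_ _≡_ f
      × (∀ i → f i ∉ closedNbhd S)
      × (∀ i j → i ≢ j → adj G (f i) (f j) ≡ true)

  IsKkIsolating : ℕ → Subset n → Set
  IsKkIsolating k S = ¬ hasCliqueOutside k S

  IsIndependent : Subset n → Set
  IsIndependent S = ∀ u v → u ∈ S → v ∈ S → adj G u v ≡ false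

  IsMinKkIsolating : ℕ → Subset n → Set
  IsMinKkIsolating k S = IsKkIsolating k S × (∀ T → IsKkIsolating k T → ∣ S ∣ ≤ ∣ T ∣)

  degIn : Subset n → Fin n → ℕ
  degIn S v = ∣ tabulate (λ u → lookup S u ∧ adj G v u) ∣

  data MinDegSeq : Subset n → List (Fin n) → Set where
    done : ∀ {S} → Empty S → MinDegSeq S []
    step : ∀ {S v vs} → v ∈ S
         → (∀ u → u ∈ S → degIn S v ≤ degIn S u)
         → MinDegSeq (S ─ closedNbhd ⁅ v ⁆) vs
         → MinDegSeq S (v ∷ vs)

module Submission where

-- Let d_i be the degree of v_i in G[S_{i-1}], D = Σ d_i and Q = Σ d_i².
-- (1) Step i removes N_{S_{i-1}}[v_i], which has 1 + d_i elements, so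
--     ι = |S| = ℓ + D; by Cauchy–Schwarz D² ≤ ℓQ.
-- (2) The chosen vertices v_1,…,v_ℓ are pairwise non-adjacent and dominate S.
--     Extending them greedily gives an independent set I with N[S] ⊆ N[I]
--     (so I is K_k-isolating) and |I| ≤ ℓ + |X|, where X = N[S] ∖ N[{v_i}].
-- (3) A vertex of X leaves the closed neighbourhood of the remaining set at the
--     step of some v_i; it is then a neighbour, outside S_{i-1}, of a neighbour
--     u of v_i in S_{i-1}. Since v_i has minimum degree, u has at most Δ − d_i
--     such neighbours, whence |X| ≤ Σ d_i(Δ − d_i) = DΔ − Q.

open import Defs
open import Algebra.Properties.CommutativeSemigroup as CSProps using ()
open import Data.Bool using (Bool; true; false; _∧_; _∨_; not)
open import Data.Bool.ListAction using (any)
open import Data.Bool.Properties using (∧-zeroʳ; ∧-identityʳ; ∧-comm; T-≡)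
open import Data.Empty using (⊥; ⊥-elim)
open import Data.Fin using (Fin; zero; suc)
open import Data.Fin.Subset using (Subset; ∣_∣; Nonempty; _∈_; _∉_; _─_; ⁅_⁆)
open import Data.Fin.Subset.Properties using (x∈⁅x⁆; x∈⁅y⁆⇒x≡y; ∣⁅x⁆∣≡1)
open import Data.List using (List; []; _∷_; length; foldr; map; allFin)
open import Data.List.Membership.Propositional using (lose) renaming (_∈_ to _∈ˡ_)
open import Data.List.Membership.Propositional.Properties using (∈-allFin)
open import Data.List.Relation.Unary.Any using (here; there; satisfied)
open import Data.List.Relation.Unary.Any.Properties using (any⁺; any⁻)
open import Data.Nat using (ℕ; zero; suc; _≤_; _+_; _*_; _⊔_; z≤n)
open import Data.Nat.ListAction using (sum)
open import Data.Nat.Properties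
open import Data.Nat.Tactic.RingSolver using (solve-∀)
open import Data.Product using (Σ; _×_; _,_; proj₁; proj₂)
open import Data.Sum using (_⊎_; inj₁; inj₂)
open import Data.Vec using (lookup; tabulate) renaming ([] to []ᵛ; _∷_ to _∷ᵛ_)
open import Data.Vec.Properties using (lookup∘tabulate; []=⇒lookup; lookup⇒[]=)
open import Function using (_∘_; Equivalence)
open import Relation.Nullary using (¬_)
open import Relation.Binary.PropositionalEquality
  using (_≡_; refl; trans; cong; cong₂; subst; subst₂) renaming (sym to ≡-sym)

open ≤-Reasoning

+-interchange : ∀ a b c d → (a + b) + (c + d) ≡ (a + c) + (b + d)
+-interchange = CSProps.interchange +-commutativeSemigroup

∧-true⁻ : ∀ {a b} → a ∧ b ≡ true → a ≡ true × b ≡ true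
∧-true⁻ {true}  {true}  _  = refl , refl
∧-true⁻ {true}  {false} ()
∧-true⁻ {false} ()

∧-true⁺ : ∀ {a b} → a ≡ true → b ≡ true → a ∧ b ≡ true
∧-true⁺ refl refl = refl

∨-true⁻ : ∀ {a b} → a ∨ b ≡ true → a ≡ true ⊎ b ≡ true
∨-true⁻ {true}  _ = inj₁ refl
∨-true⁻ {false} e = inj₂ e

∨-trueˡ : ∀ {a} b → a ≡ true → a ∨ b ≡ true
∨-trueˡ _ refl = refl

∨-trueʳ : ∀ a {b} → b ≡ true → a ∨ b ≡ true
∨-trueʳ true  _ = refl
∨-trueʳ false e = e

not-true⁻ : ∀ {b} → not b ≡ true → b ≡ false
not-true⁻ {false} _ = refl
not-true⁻ {true}  ()

not-true⁺ : ∀ {b} → b ≡ false → not b ≡ true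
not-true⁺ refl = refl

not-false⁻ : ∀ {b} → not b ≡ false → b ≡ true
not-false⁻ {true}  _ = refl
not-false⁻ {false} ()

¬true⇒false : ∀ {b} → ¬ b ≡ true → b ≡ false
¬true⇒false {true}  h = ⊥-elim (h refl)
¬true⇒false {false} _ = refl

true≢false : ∀ {b} → b ≡ true → b ≡ false → ⊥
true≢false refl ()

bool-ext : ∀ {a b} → (a ≡ true → b ≡ true) → (b ≡ true → a ≡ true) → a ≡ b
bool-ext {true}          f _ = ≡-sym (f refl)
bool-ext {false} {true}  _ g = g refl
bool-ext {false} {false} _ _ = refl

-- A decidable set of elements of Fin m, given by its indicator function;
-- counting is easiest for these, and `Subset`s are converted via `lookup`.
DSet : ℕ → Set
DSet m = Fin m → Bool

infixl 7 _∩_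
infixl 6 _∪_ _∖_
infix  4 _⊑_

_∪_ _∩_ _∖_ : ∀ {m} → DSet m → DSet m → DSet m
(A ∪ B) x = A x ∨ B x
(A ∩ B) x = A x ∧ B x
(A ∖ B) x = A x ∧ not (B x)

_⊑_ : ∀ {m} → DSet m → DSet m → Set
A ⊑ B = ∀ x → A x ≡ true → B x ≡ true

∈⇒true : ∀ {m} {p : Subset m} {x} → x ∈ p → lookup p x ≡ true
∈⇒true = []=⇒lookup

true⇒∈ : ∀ {m} {p : Subset m} {x} → lookup p x ≡ true → x ∈ p
true⇒∈ {p = p} {x} = lookup⇒[]= x p

∈tabulate⁻ : ∀ {m} {A : DSet m} {x} → x ∈ tabulate A → A x ≡ true
∈tabulate⁻ {A = A} {x} x∈ = trans (≡-sym (lookup∘tabulate A x)) (∈⇒true x∈)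

lookup-─ : ∀ {m} (p q : Subset m) x → lookup (p ─ q) x ≡ (lookup p ∖ lookup q) x
lookup-─ (a ∷ᵛ p) (true  ∷ᵛ q) zero    = ≡-sym (∧-zeroʳ a)
lookup-─ (a ∷ᵛ p) (false ∷ᵛ q) zero    = ≡-sym (∧-identityʳ a)
lookup-─ (_ ∷ᵛ p) (_     ∷ᵛ q) (suc x) = lookup-─ p q x

⁅⁆-self : ∀ {m} (v : Fin m) → lookup ⁅ v ⁆ v ≡ true
⁅⁆-self v = ∈⇒true (x∈⁅x⁆ v)

⁅⁆⇒≡ : ∀ {m} {v x : Fin m} → lookup ⁅ v ⁆ x ≡ true → x ≡ v
⁅⁆⇒≡ {v = v} e = x∈⁅y⁆⇒x≡y v (true⇒∈ e)

bit : Bool → ℕ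
bit true  = 1
bit false = 0

count : ∀ {m} → DSet m → ℕ
count {zero}  A = 0
count {suc m} A = bit (A zero) + count (A ∘ suc)

count-cong : ∀ {m} {A B : DSet m} → (∀ x → A x ≡ B x) → count A ≡ count B
count-cong {zero}  _ = refl
count-cong {suc m} e = cong₂ _+_ (cong bit (e zero)) (count-cong (e ∘ suc))

count-mono : ∀ {m} {A B : DSet m} → A ⊑ B → count A ≤ count B
count-mono {zero}  _   = z≤n
count-mono {suc m} A⊑B = +-mono-≤ (bit-mono (A⊑B zero)) (count-mono (A⊑B ∘ suc))
  where
  bit-mono : ∀ {a b} → (a ≡ true → b ≡ true) → bit a ≤ bit b
  bit-mono {false} _ = z≤n
  bit-mono {true}  h rewrite h refl = ≤-refl

count-empty : ∀ {m} (A : DSet m) → (∀ x → A x ≡ false) → count A ≡ 0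
count-empty {zero}  _ _ = refl
count-empty {suc m} A h rewrite h zero = count-empty (A ∘ suc) (h ∘ suc)

count-∪ : ∀ {m} (A B : DSet m) → count (A ∪ B) ≤ count A + count B
count-∪ {zero}  _ _ = z≤n
count-∪ {suc m} A B = begin
  bit (A zero ∨ B zero) + count ((A ∪ B) ∘ suc)
    ≤⟨ +-mono-≤ (bit-∨ (A zero) (B zero)) (count-∪ (A ∘ suc) (B ∘ suc)) ⟩
  (bit (A zero) + bit (B zero)) + (count (A ∘ suc) + count (B ∘ suc))
    ≡⟨ +-interchange (bit (A zero)) _ _ _ ⟩
  (bit (A zero) + count (A ∘ suc)) + (bit (B zero) + count (B ∘ suc)) ∎
  where
  bit-∨ : ∀ a b → bit (a ∨ b) ≤ bit a + bit b
  bit-∨ true  _ = m≤m+n 1 _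
  bit-∨ false _ = ≤-refl

count-split : ∀ {m} (A B : DSet m) → count A ≡ count (A ∩ B) + count (A ∖ B)
count-split {zero}  _ _ = refl
count-split {suc m} A B = trans
  (cong₂ _+_ (bit-split (A zero) (B zero)) (count-split (A ∘ suc) (B ∘ suc)))
  (+-interchange (bit (A zero ∧ B zero)) _ _ _)
  where
  bit-split : ∀ a b → bit a ≡ bit (a ∧ b) + bit (a ∧ not b)
  bit-split true  true  = refl
  bit-split true  false = refl
  bit-split false _     = refl

∣∣≡count : ∀ {m} (p : Subset m) → ∣ p ∣ ≡ count (lookup p)
∣∣≡count []ᵛ          = refl
∣∣≡count (true  ∷ᵛ p) = cong suc (∣∣≡count p)
∣∣≡count (false ∷ᵛ p) = ∣∣≡count p

∣tabulate∣ : ∀ {m} (A : DSet m) → ∣ tabulate A ∣ ≡ count A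
∣tabulate∣ A = trans (∣∣≡count (tabulate A)) (count-cong (lookup∘tabulate A))

count-⁅⁆ : ∀ {m} (v : Fin m) → count (lookup ⁅ v ⁆) ≡ 1
count-⁅⁆ v = trans (≡-sym (∣∣≡count ⁅ v ⁆)) (∣⁅x⁆∣≡1 v)

elements : ∀ {m} → List (Fin m) → DSet m
elements []       = λ _ → false
elements (v ∷ vs) = lookup ⁅ v ⁆ ∪ elements vs

count-elements : ∀ {m} (vs : List (Fin m)) → count (elements vs) ≤ length vs
count-elements {m} []  = ≤-reflexive (count-empty {m} _ (λ _ → refl))
count-elements (v ∷ vs) = ≤-trans (count-∪ (lookup ⁅ v ⁆) (elements vs))
  (+-mono-≤ (≤-reflexive (count-⁅⁆ v)) (count-elements vs))

⋃ : ∀ {m k} → (Fin m → DSet k) → DSet k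
⋃ {zero}  H = λ _ → false
⋃ {suc m} H = H zero ∪ ⋃ (H ∘ suc)

∑ : ∀ {m} → (Fin m → ℕ) → ℕ
∑ {zero}  g = 0
∑ {suc m} g = g zero + ∑ (g ∘ suc)

⋃-intro : ∀ {m k} (H : Fin m → DSet k) u {x} → H u x ≡ true → ⋃ H x ≡ true
⋃-intro H zero    e = ∨-trueˡ _ e
⋃-intro H (suc u) e = ∨-trueʳ (H zero _) (⋃-intro (H ∘ suc) u e)

count-⋃ : ∀ {m k} (H : Fin m → DSet k) → count (⋃ H) ≤ ∑ (count ∘ H)
count-⋃ {zero} {k} H = ≤-reflexive (count-empty {k} _ (λ _ → refl))
count-⋃ {suc m} H = ≤-trans (count-∪ (H zero) (⋃ (H ∘ suc)))
  (+-monoʳ-≤ (count (H zero)) (count-⋃ (H ∘ suc)))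

∑-bound : ∀ {m} (P : DSet m) (g : Fin m → ℕ) d Δ
  → (∀ u → P u ≡ true → g u + d ≤ Δ) → (∀ u → P u ≡ false → g u ≡ 0)
  → ∑ g + count P * d ≤ count P * Δ
∑-bound {zero}  _ _ _ _ _ _ = z≤n
∑-bound {suc m} P g d Δ on off with P zero in eq
... | true  = begin
  (g zero + ∑ (g ∘ suc)) + (d + count (P ∘ suc) * d)
    ≡⟨ +-interchange (g zero) _ _ _ ⟩
  (g zero + d) + (∑ (g ∘ suc) + count (P ∘ suc) * d)
    ≤⟨ +-mono-≤ (on zero eq) (∑-bound (P ∘ suc) (g ∘ suc) d Δ (on ∘ suc) (off ∘ suc)) ⟩
  Δ + count (P ∘ suc) * Δ ∎
... | false rewrite off zero eq = ∑-bound (P ∘ suc) (g ∘ suc) d Δ (on ∘ suc) (off ∘ suc)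

2cd≤c²+d²-ordered : ∀ {c d} → c ≤ d → 2 * c * d ≤ c * c + d * d
2cd≤c²+d²-ordered {c} c≤d with m≤n⇒∃[o]m+o≡n c≤d
... | k , refl = ≤-trans (m≤m+n _ (k * k)) (≤-reflexive (gap c k))
  where
  gap : ∀ c k → 2 * c * (c + k) + k * k ≡ c * c + (c + k) * (c + k)
  gap = solve-∀

2cd≤c²+d² : ∀ c d → 2 * c * d ≤ c * c + d * d
2cd≤c²+d² c d with ≤-total c d
... | inj₁ c≤d = 2cd≤c²+d²-ordered c≤d
... | inj₂ d≤c = subst₂ _≤_ (swap₁ d c) (swap₂ d c) (2cd≤c²+d²-ordered d≤c)
  where
  swap₁ : ∀ d c → 2 * d * c ≡ 2 * c * d
  swap₁ = solve-∀
  swap₂ : ∀ d c → d * d + c * c ≡ c * c + d * d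
  swap₂ = solve-∀

sum-of-squares : List ℕ → ℕ
sum-of-squares ds = sum (map (λ d → d * d) ds)

-- Summing AM–GM termwise: 2c·Σd ≤ Σd² + ℓc².  This is the induction
-- hypothesis needed for Cauchy–Schwarz.
cross-term-bound : ∀ c ds → 2 * c * sum ds ≤ sum-of-squares ds + length ds * (c * c)
cross-term-bound c []       = ≤-reflexive (*-zeroʳ (2 * c))
cross-term-bound c (d ∷ ds) = begin
  2 * c * (d + D)                      ≡⟨ *-distribˡ-+ (2 * c) d D ⟩
  2 * c * d + 2 * c * D                ≤⟨ +-mono-≤ (2cd≤c²+d² c d) (cross-term-bound c ds) ⟩
  (c * c + d * d) + (Q + ℓ * (c * c))  ≡⟨ regroup c d Q ℓ ⟩
  (d * d + Q) + suc ℓ * (c * c)        ∎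
  where
  D Q ℓ : ℕ
  D = sum ds
  Q = sum-of-squares ds
  ℓ = length ds
  regroup : ∀ c d Q ℓ → (c * c + d * d) + (Q + ℓ * (c * c)) ≡ (d * d + Q) + suc ℓ * (c * c)
  regroup = solve-∀

cauchy-schwarz : ∀ ds → sum ds * sum ds ≤ length ds * sum-of-squares ds
cauchy-schwarz []       = z≤n
cauchy-schwarz (d ∷ ds) = begin
  (d + D) * (d + D)                    ≡⟨ expand d D ⟩
  d * d + 2 * d * D + D * D            ≤⟨ +-mono-≤ (+-monoʳ-≤ (d * d) (cross-term-bound d ds)) (cauchy-schwarz ds) ⟩
  d * d + (Q + ℓ * (d * d)) + ℓ * Q    ≡⟨ collect d Q ℓ ⟩
  suc ℓ * (d * d + Q)                  ∎
  where
  D Q ℓ : ℕ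
  D = sum ds
  Q = sum-of-squares ds
  ℓ = length ds
  expand : ∀ d D → (d + D) * (d + D) ≡ d * d + 2 * d * D + D * D
  expand = solve-∀
  collect : ∀ d Q ℓ → d * d + (Q + ℓ * (d * d)) + ℓ * Q ≡ suc ℓ * (d * d + Q)
  collect = solve-∀

final-inequality : ∀ {ℓ i X D Q Δ ι} → ι ≡ ℓ + D
  → i ≤ ℓ + X → X + Q ≤ D * Δ → D * D ≤ ℓ * Q
  → ℓ * i + ι * ι + ℓ * ℓ * Δ ≤ ℓ * ι * (Δ + 2)
final-inequality {ℓ} {i} {X} {D} {Q} {Δ} refl i≤ X+Q≤ D²≤ = begin
  ℓ * i + (ℓ + D) * (ℓ + D) + ℓ * ℓ * Δ
    ≤⟨ +-monoˡ-≤ (ℓ * ℓ * Δ) (+-monoˡ-≤ ((ℓ + D) * (ℓ + D)) (*-monoʳ-≤ ℓ i≤)) ⟩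
  ℓ * (ℓ + X) + (ℓ + D) * (ℓ + D) + ℓ * ℓ * Δ
    ≡⟨ expand ℓ X D Δ ⟩
  ℓ * X + D * D + R
    ≤⟨ +-monoˡ-≤ R (+-monoʳ-≤ (ℓ * X) D²≤) ⟩
  ℓ * X + ℓ * Q + R
    ≡⟨ cong (_+ R) (≡-sym (*-distribˡ-+ ℓ X Q)) ⟩
  ℓ * (X + Q) + R
    ≤⟨ +-monoˡ-≤ R (*-monoʳ-≤ ℓ X+Q≤) ⟩
  ℓ * (D * Δ) + R
    ≡⟨ collect ℓ D Δ ⟩
  ℓ * (ℓ + D) * (Δ + 2) ∎
  where
  R : ℕ
  R = 2 * ℓ * ℓ + 2 * ℓ * D + ℓ * ℓ * Δ
  expand : ∀ ℓ X D Δ → ℓ * (ℓ + X) + (ℓ + D) * (ℓ + D) + ℓ * ℓ * Δ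
                     ≡ ℓ * X + D * D + (2 * ℓ * ℓ + 2 * ℓ * D + ℓ * ℓ * Δ)
  expand = solve-∀
  collect : ∀ ℓ D Δ → ℓ * (D * Δ) + (2 * ℓ * ℓ + 2 * ℓ * D + ℓ * ℓ * Δ) ≡ ℓ * (ℓ + D) * (Δ + 2)
  collect = solve-∀

≤foldr⊔ : ∀ {A : Set} (h : A → ℕ) {xs x} → x ∈ˡ xs → h x ≤ foldr _⊔_ 0 (map h xs)
≤foldr⊔ h {y ∷ _} (here refl) = m≤m⊔n (h y) _
≤foldr⊔ h {y ∷ _} (there x∈)  = ≤-trans (≤foldr⊔ h x∈) (m≤n⊔m (h y) _)

module GraphLemmas {n : ℕ} (G : Graph n) where

  N[_] : DSet n → DSet n
  N[ A ] x = A x ∨ any (λ v → A v ∧ adj G x v) (allFin n)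

  N₁[_] : Fin n → DSet n
  N₁[ v ] = N[ lookup ⁅ v ⁆ ]

  Independentᵇ : DSet n → Set
  Independentᵇ A = ∀ u w → A u ≡ true → A w ≡ true → adj G u w ≡ false

  closedNbhd-lookup : ∀ (S : Subset n) x → lookup (closedNbhd G S) x ≡ N[ lookup S ] x
  closedNbhd-lookup S = lookup∘tabulate _

  N[]-self : ∀ A → A ⊑ N[ A ]
  N[]-self A _ e = ∨-trueˡ _ e

  N[]-adj : ∀ A {x v} → A v ≡ true → adj G x v ≡ true → N[ A ] x ≡ true
  N[]-adj A {x} {v} Av xv = ∨-trueʳ (A x)
    (Equivalence.to T-≡ (any⁺ _ (lose (∈-allFin v) (Equivalence.from T-≡ (∧-true⁺ Av xv)))))

  N[]-elim : ∀ A x → N[ A ] x ≡ true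
    → A x ≡ true ⊎ Σ (Fin n) λ v → A v ≡ true × adj G x v ≡ true
  N[]-elim A x e with ∨-true⁻ {A x} e
  ... | inj₁ Ax = inj₁ Ax
  ... | inj₂ e′ with satisfied (any⁻ _ (allFin n) (Equivalence.from T-≡ e′))
  ...   | v , Tv = inj₂ (v , ∧-true⁻ (Equivalence.to T-≡ Tv))

  N[]-mono : ∀ {A B} → A ⊑ B → N[ A ] ⊑ N[ B ]
  N[]-mono {A} {B} A⊑B x e with N[]-elim A x e
  ... | inj₁ Ax          = N[]-self B x (A⊑B x Ax)
  ... | inj₂ (v , Av , a) = N[]-adj B (A⊑B v Av) a

  N₁-self : ∀ v → N₁[ v ] v ≡ true
  N₁-self v = N[]-self _ v (⁅⁆-self v)

  N₁-adj : ∀ {v x} → adj G x v ≡ true → N₁[ v ] x ≡ true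
  N₁-adj {v} = N[]-adj _ (⁅⁆-self v)

  N₁-elim : ∀ {v x} → N₁[ v ] x ≡ true → x ≡ v ⊎ adj G x v ≡ true
  N₁-elim {v} {x} e with N[]-elim _ x e
  ... | inj₁ x∈ = inj₁ (⁅⁆⇒≡ {v = v} x∈)
  ... | inj₂ (w , w∈ , a) with ⁅⁆⇒≡ {v = v} {x = w} w∈
  ...   | refl = inj₂ a

  lookup-remaining : ∀ (T : Subset n) v x
    → lookup (T ─ closedNbhd G ⁅ v ⁆) x ≡ (lookup T ∖ N₁[ v ]) x
  lookup-remaining T v x =
    trans (lookup-─ T _ x) (cong (λ b → lookup T x ∧ not b) (closedNbhd-lookup ⁅ v ⁆ x))

  remaining⁻ : ∀ (T : Subset n) v {x} → lookup (T ─ closedNbhd G ⁅ v ⁆) x ≡ true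
    → lookup T x ≡ true × N₁[ v ] x ≡ false
  remaining⁻ T v {x} e with ∧-true⁻ (trans (≡-sym (lookup-remaining T v x)) e)
  ... | Tx , ¬N = Tx , not-true⁻ ¬N

  remaining⁺ : ∀ (T : Subset n) v {x} → lookup T x ≡ true → N₁[ v ] x ≡ false
    → lookup (T ─ closedNbhd G ⁅ v ⁆) x ≡ true
  remaining⁺ T v {x} Tx ¬N = trans (lookup-remaining T v x) (∧-true⁺ Tx (not-true⁺ ¬N))

  degree≤maxDegree : ∀ u → count (adj G u) ≤ maxDegree G
  degree≤maxDegree u = begin
    count (adj G u) ≡⟨ ≡-sym (∣tabulate∣ (adj G u)) ⟩
    degree G u      ≤⟨ ≤foldr⊔ (degree G) (∈-allFin u) ⟩
    maxDegree G     ∎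

  isolating-mono : ∀ k (S I : Subset n) → N[ lookup S ] ⊑ N[ lookup I ]
    → IsKkIsolating G k S → IsKkIsolating G k I
  isolating-mono k S I S⊑I S-iso (f , f-inj , f-outside , f-clique) =
    S-iso (f , f-inj , outside-S , f-clique)
    where
    outside-S : ∀ i → f i ∉ closedNbhd G S
    outside-S i fi∈ = f-outside i (true⇒∈ (trans (closedNbhd-lookup I (f i))
      (S⊑I (f i) (trans (≡-sym (closedNbhd-lookup S (f i))) (∈⇒true fi∈)))))

  elements⊑start : ∀ {T vs} → MinDegSeq G T vs → elements vs ⊑ lookup T
  elements⊑start (done _) _ ()
  elements⊑start (step {T} {v} v∈ _ rest) x e with ∨-true⁻ {lookup ⁅ v ⁆ x} e
  ... | inj₂ later = proj₁ (remaining⁻ T v (elements⊑start rest x later))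
  ... | inj₁ x=v with ⁅⁆⇒≡ {v = v} {x = x} x=v
  ...   | refl = ∈⇒true v∈

  later-nonadjacent : ∀ {T v vs x} → MinDegSeq G (T ─ closedNbhd G ⁅ v ⁆) vs
    → elements vs x ≡ true → adj G x v ≡ false
  later-nonadjacent {T} {v} rest e = ¬true⇒false λ xv →
    true≢false (N₁-adj xv) (proj₂ (remaining⁻ T v (elements⊑start rest _ e)))

  elements-independent : ∀ {T vs} → MinDegSeq G T vs → Independentᵇ (elements vs)
  elements-independent (done _) _ _ ()
  elements-independent (step {v = v} _ _ rest) u w eu ew
    with ∨-true⁻ {lookup ⁅ v ⁆ u} eu | ∨-true⁻ {lookup ⁅ v ⁆ w} ew
  ... | inj₂ u-later | inj₂ w-later = elements-independent rest u w u-later w-later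
  ... | inj₂ u-later | inj₁ w=v with ⁅⁆⇒≡ {v = v} {x = w} w=v
  ...   | refl = later-nonadjacent rest u-later
  elements-independent (step {v = v} _ _ rest) u w _ _ | inj₁ u=v | inj₂ w-later
    with ⁅⁆⇒≡ {v = v} {x = u} u=v
  ...   | refl = trans (sym G v w) (later-nonadjacent rest w-later)
  elements-independent (step {v = v} _ _ rest) u w _ _ | inj₁ u=v | inj₁ w=v
    with ⁅⁆⇒≡ {v = v} {x = u} u=v | ⁅⁆⇒≡ {v = v} {x = w} w=v
  ...   | refl | refl = irref G v

  start⊑N[elements] : ∀ {T vs} → MinDegSeq G T vs → lookup T ⊑ N[ elements vs ]
  start⊑N[elements] (done empty) t Tt = ⊥-elim (empty (t , true⇒∈ Tt))
  start⊑N[elements] (step {T} {v} _ _ rest) t Tt with N₁[ v ] t in t∈N₁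
  ... | false = N[]-mono (λ y e → ∨-trueʳ (lookup ⁅ v ⁆ y) e) t
                  (start⊑N[elements] rest t (remaining⁺ T v Tt t∈N₁))
  ... | true with N₁-elim {v} {t} t∈N₁
  ...   | inj₁ refl = N[]-self _ t (∨-trueˡ _ (⁅⁆-self t))
  ...   | inj₂ tv   = N[]-adj _ (∨-trueˡ _ (⁅⁆-self v)) tv

  degrees : ∀ {T vs} → MinDegSeq G T vs → List ℕ
  degrees (done _)                 = []
  degrees (step {T} {v} _ _ rest) = degIn G T v ∷ degrees rest

  length-degrees : ∀ {T vs} (sq : MinDegSeq G T vs) → length (degrees sq) ≡ length vs
  length-degrees (done _)        = refl
  length-degrees (step _ _ rest) = cong suc (length-degrees rest)

  nbrsIn : Subset n → Fin n → DSet n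
  nbrsIn T v u = lookup T u ∧ adj G v u

  count-nbrsIn : ∀ T v → count (nbrsIn T v) ≡ degIn G T v
  count-nbrsIn T v = ≡-sym (∣tabulate∣ (nbrsIn T v))

  count-N₁ : ∀ (T : Subset n) {v} → v ∈ T → count (lookup T ∩ N₁[ v ]) ≡ 1 + degIn G T v
  count-N₁ T {v} v∈ = begin-equality
    count (lookup T ∩ N₁[ v ])
      ≡⟨ count-split _ (lookup ⁅ v ⁆) ⟩
    count (lookup T ∩ N₁[ v ] ∩ lookup ⁅ v ⁆) + count (lookup T ∩ N₁[ v ] ∖ lookup ⁅ v ⁆)
      ≡⟨ cong₂ _+_ (trans (count-cong centre) (count-⁅⁆ v))
                   (trans (count-cong punctured) (count-nbrsIn T v)) ⟩
    1 + degIn G T v ∎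
    where
    centre : ∀ x → (lookup T ∩ N₁[ v ] ∩ lookup ⁅ v ⁆) x ≡ lookup ⁅ v ⁆ x
    centre x = bool-ext (λ e → proj₂ (∧-true⁻ e)) into
      where
      into : lookup ⁅ v ⁆ x ≡ true → (lookup T ∩ N₁[ v ] ∩ lookup ⁅ v ⁆) x ≡ true
      into e with ⁅⁆⇒≡ {v = v} {x = x} e
      ... | refl = ∧-true⁺ (∧-true⁺ (∈⇒true v∈) (N₁-self v)) e

    punctured : ∀ x → (lookup T ∩ N₁[ v ] ∖ lookup ⁅ v ⁆) x ≡ nbrsIn T v x
    punctured x = bool-ext out into
      where
      out : (lookup T ∩ N₁[ v ] ∖ lookup ⁅ v ⁆) x ≡ true → nbrsIn T v x ≡ true
      out e with ∧-true⁻ e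
      ... | TN , x≠v with ∧-true⁻ TN
      ...   | Tx , x∈N₁ with N₁-elim {v} {x} x∈N₁
      ...     | inj₁ refl = ⊥-elim (true≢false (⁅⁆-self x) (not-true⁻ x≠v))
      ...     | inj₂ xv   = ∧-true⁺ Tx (trans (sym G v x) xv)
      into : nbrsIn T v x ≡ true → (lookup T ∩ N₁[ v ] ∖ lookup ⁅ v ⁆) x ≡ true
      into e with ∧-true⁻ e
      ... | Tx , vx = ∧-true⁺ (∧-true⁺ Tx (N₁-adj (trans (sym G x v) vx))) (not-true⁺ x∉⁅v⁆)
        where
        x∉⁅v⁆ : lookup ⁅ v ⁆ x ≡ false
        x∉⁅v⁆ = ¬true⇒false λ x=v → true≢false vx (loop (⁅⁆⇒≡ {v = v} {x = x} x=v))
          where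
          loop : x ≡ v → adj G v x ≡ false
          loop refl = irref G x

  -- (1) ι = ℓ + Σ d_i: step i removes N_{S_{i-1}}[v_i].
  count-start : ∀ {T vs} (sq : MinDegSeq G T vs) → count (lookup T) ≡ length vs + sum (degrees sq)
  count-start (done empty) = count-empty _ λ x → ¬true⇒false λ Tx → empty (x , true⇒∈ Tx)
  count-start (step {T} {v} {vs} v∈ _ rest) = begin-equality
    count (lookup T)
      ≡⟨ count-split (lookup T) N₁[ v ] ⟩
    count (lookup T ∩ N₁[ v ]) + count (lookup T ∖ N₁[ v ])
      ≡⟨ cong₂ _+_ (count-N₁ T v∈)
           (trans (count-cong λ x → ≡-sym (lookup-remaining T v x)) (count-start rest)) ⟩
    (1 + degIn G T v) + (length vs + sum (degrees rest))
      ≡⟨ +-interchange 1 (degIn G T v) (length vs) _ ⟩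
    suc (length vs) + (degIn G T v + sum (degrees rest)) ∎

  -- (3), one step: if v has minimum degree d in G[T], then at most d(Δ − d)
  -- vertices outside T are adjacent to a neighbour of v in T, since each such
  -- neighbour u has d_T(u) ≥ d neighbours inside T.
  layer-bound : ∀ (T : Subset n) v → (∀ u → u ∈ T → degIn G T v ≤ degIn G T u)
    → (Y : DSet n)
    → (∀ x → Y x ≡ true → Σ (Fin n) λ u →
         nbrsIn T v u ≡ true × adj G u x ≡ true × lookup T x ≡ false)
    → count Y + degIn G T v * degIn G T v ≤ degIn G T v * maxDegree G
  layer-bound T v minimal Y Y-reached =
    subst (λ d → count Y + d * d ≤ d * maxDegree G) (count-nbrsIn T v) (begin
      count Y + count P * count P
        ≤⟨ +-monoˡ-≤ _ (≤-trans (count-mono Y⊑⋃) (count-⋃ outer)) ⟩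
      ∑ (count ∘ outer) + count P * count P
        ≤⟨ ∑-bound P (count ∘ outer) (count P) (maxDegree G) on-P off-P ⟩
      count P * maxDegree G ∎)
    where
    P : DSet n
    P = nbrsIn T v
    outer : Fin n → DSet n
    outer u x = P u ∧ (adj G u x ∧ not (lookup T x))

    Y⊑⋃ : Y ⊑ ⋃ outer
    Y⊑⋃ x Yx with Y-reached x Yx
    ... | u , Pu , ux , x∉T = ⋃-intro outer u (∧-true⁺ Pu (∧-true⁺ ux (not-true⁺ x∉T)))

    on-P : ∀ u → P u ≡ true → count (outer u) + count P ≤ maxDegree G
    on-P u Pu = begin
      count (outer u) + count P
        ≡⟨ cong₂ _+_ (count-cong λ x → cong (_∧ (adj G u x ∧ not (lookup T x))) Pu) (count-nbrsIn T v) ⟩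
      count (adj G u ∖ lookup T) + degIn G T v
        ≤⟨ +-monoʳ-≤ _ (minimal u (true⇒∈ (proj₁ (∧-true⁻ Pu)))) ⟩
      count (adj G u ∖ lookup T) + degIn G T u
        ≡⟨ cong (count (adj G u ∖ lookup T) +_) (trans (≡-sym (count-nbrsIn T u))
             (count-cong λ x → ∧-comm (lookup T x) (adj G u x))) ⟩
      count (adj G u ∖ lookup T) + count (adj G u ∩ lookup T)
        ≡⟨ +-comm (count (adj G u ∖ lookup T)) _ ⟩
      count (adj G u ∩ lookup T) + count (adj G u ∖ lookup T)
        ≡⟨ ≡-sym (count-split (adj G u) (lookup T)) ⟩
      count (adj G u)
        ≤⟨ degree≤maxDegree u ⟩
      maxDegree G ∎

    off-P : ∀ u → P u ≡ false → count (outer u) ≡ 0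
    off-P u ¬Pu = count-empty (outer u) λ x → cong (_∧ (adj G u x ∧ not (lookup T x))) ¬Pu

  -- Such a vertex is either still dominated by the
  -- remaining set (induction) or is counted by `layer-bound` at this step.
  undominated-bound : ∀ {T vs} (sq : MinDegSeq G T vs) (Z : DSet n)
    → Z ⊑ N[ lookup T ] → (∀ x → Z x ≡ true → N[ elements vs ] x ≡ false)
    → count Z + sum-of-squares (degrees sq) ≤ sum (degrees sq) * maxDegree G
  undominated-bound (done empty) Z Z⊑ _ =
    ≤-reflexive (trans (+-identityʳ _) (count-empty Z λ x → ¬true⇒false (nowhere x)))
    where
    nowhere : ∀ x → ¬ Z x ≡ true
    nowhere x Zx with N[]-elim _ x (Z⊑ x Zx)
    ... | inj₁ Tx           = empty (x , true⇒∈ Tx)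
    ... | inj₂ (t , Tt , _) = empty (t , true⇒∈ Tt)
  undominated-bound sq@(step {T} {v} {vs} v∈ minimal rest) Z Z⊑ Z-undominated = begin
    count Z + (d * d + Q)
      ≡⟨ cong (_+ (d * d + Q)) (trans (count-split Z N′) (+-comm (count (Z ∩ N′)) _)) ⟩
    (count (Z ∖ N′) + count (Z ∩ N′)) + (d * d + Q)
      ≡⟨ +-interchange (count (Z ∖ N′)) _ _ _ ⟩
    (count (Z ∖ N′) + d * d) + (count (Z ∩ N′) + Q)
      ≤⟨ +-mono-≤ (layer-bound T v minimal (Z ∖ N′) leaving)
                  (undominated-bound rest (Z ∩ N′) (λ x e → proj₂ (∧-true⁻ e)) staying) ⟩
    d * Δ + D * Δ
      ≡⟨ ≡-sym (*-distribʳ-+ Δ d D) ⟩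
    (d + D) * Δ ∎
    where
    d D Q Δ : ℕ
    d = degIn G T v
    D = sum (degrees rest)
    Q = sum-of-squares (degrees rest)
    Δ = maxDegree G
    N′ : DSet n
    N′ = N[ lookup (T ─ closedNbhd G ⁅ v ⁆) ]

    staying : ∀ x → (Z ∩ N′) x ≡ true → N[ elements vs ] x ≡ false
    staying x e = ¬true⇒false λ dominated →
      true≢false (N[]-mono (λ y → ∨-trueʳ (lookup ⁅ v ⁆ y)) x dominated)
                 (Z-undominated x (proj₁ (∧-true⁻ e)))

    leaving : ∀ x → (Z ∖ N′) x ≡ true → Σ (Fin n) λ u →
      nbrsIn T v u ≡ true × adj G u x ≡ true × lookup T x ≡ false
    leaving x e = via (N[]-elim _ x (Z⊑ x Zx))
      where
      Zx : Z x ≡ true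
      Zx = proj₁ (∧-true⁻ e)
      x∉N′ : N′ x ≡ false
      x∉N′ = not-true⁻ (proj₂ (∧-true⁻ e))
      undominated : N[ elements (v ∷ vs) ] x ≡ false
      undominated = Z-undominated x Zx
      x∉T : lookup T x ≡ false
      x∉T = ¬true⇒false λ Tx → true≢false (start⊑N[elements] sq x Tx) undominated

      via : lookup T x ≡ true ⊎ Σ (Fin n) (λ t → lookup T t ≡ true × adj G x t ≡ true)
        → Σ (Fin n) λ u → nbrsIn T v u ≡ true × adj G u x ≡ true × lookup T x ≡ false
      via (inj₁ Tx) = ⊥-elim (true≢false Tx x∉T)
      via (inj₂ (t , Tt , xt)) with N₁[ v ] t in t∈N₁
      ... | false = ⊥-elim (true≢false (N[]-adj _ (remaining⁺ T v Tt t∈N₁) xt) x∉N′)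
      ... | true with N₁-elim {v} {t} t∈N₁
      ...   | inj₁ refl = ⊥-elim (true≢false (N[]-adj _ (∨-trueˡ _ (⁅⁆-self t)) xt) undominated)
      ...   | inj₂ tv   = t , ∧-true⁺ Tt (trans (sym G v t) tv) , trans (sym G t x) xt , x∉T

  module Greedy (A C : DSet n) where
    admissible : DSet n → Fin n → Bool
    admissible F c = C c ∧ not (N[ F ] c)

    add : Bool → DSet n → Fin n → DSet n
    add true  F c = F ∪ lookup ⁅ c ⁆
    add false F c = F

    extend : DSet n → List (Fin n) → DSet n
    extend F []       = F
    extend F (c ∷ cs) = extend (add (admissible F c) F c) cs

    Invariant : DSet n → Set
    Invariant F = Independentᵇ F × A ⊑ F × F ⊑ A ∪ (C ∖ N[ A ])

    add-grows : ∀ b F c → F ⊑ add b F c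
    add-grows true  F c _ e = ∨-trueˡ _ e
    add-grows false F c _ e = e

    extend-grows : ∀ F cs → F ⊑ extend F cs
    extend-grows F []       _ e = e
    extend-grows F (c ∷ cs) x e = extend-grows _ cs x (add-grows (admissible F c) F c x e)

    add-invariant : ∀ b F c → admissible F c ≡ b → Invariant F → Invariant (add b F c)
    add-invariant false F c _  inv                  = inv
    add-invariant true  F c ok (F-indep , A⊑F , F⊑) =
      indep , (λ x e → ∨-trueˡ _ (A⊑F x e)) , bounded
      where
      c∉N[F] : N[ F ] c ≡ false
      c∉N[F] = not-true⁻ (proj₂ (∧-true⁻ ok))

      apart : ∀ {u} → F u ≡ true → adj G c u ≡ false
      apart Fu = ¬true⇒false λ cu → true≢false (N[]-adj F Fu cu) c∉N[F]

      indep : Independentᵇ (F ∪ lookup ⁅ c ⁆)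
      indep u w eu ew with ∨-true⁻ {F u} eu | ∨-true⁻ {F w} ew
      ... | inj₁ Fu | inj₁ Fw = F-indep u w Fu Fw
      ... | inj₁ Fu | inj₂ w=c with ⁅⁆⇒≡ {v = c} {x = w} w=c
      ...   | refl = trans (sym G u c) (apart Fu)
      indep u w _ _ | inj₂ u=c | inj₁ Fw with ⁅⁆⇒≡ {v = c} {x = u} u=c
      ...   | refl = apart Fw
      indep u w _ _ | inj₂ u=c | inj₂ w=c
        with ⁅⁆⇒≡ {v = c} {x = u} u=c | ⁅⁆⇒≡ {v = c} {x = w} w=c
      ...   | refl | refl = irref G c

      bounded : F ∪ lookup ⁅ c ⁆ ⊑ A ∪ (C ∖ N[ A ])
      bounded x e with ∨-true⁻ {F x} e
      ... | inj₁ Fx = F⊑ x Fx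
      ... | inj₂ x=c with ⁅⁆⇒≡ {v = c} {x = x} x=c
      ...   | refl = ∨-trueʳ (A x) (∧-true⁺ (proj₁ (∧-true⁻ ok)) (not-true⁺ c∉N[A]))
        where
        c∉N[A] : N[ A ] x ≡ false
        c∉N[A] = ¬true⇒false λ c∈ → true≢false (N[]-mono A⊑F x c∈) c∉N[F]

    extend-invariant : ∀ F cs → Invariant F → Invariant (extend F cs)
    extend-invariant F []       inv = inv
    extend-invariant F (c ∷ cs) inv = extend-invariant _ cs (add-invariant _ F c refl inv)

    add-dominates : ∀ b F c → admissible F c ≡ b → C c ≡ true → N[ add b F c ] c ≡ true
    add-dominates true  F c _      _  = N[]-self _ c (∨-trueʳ (F c) (⁅⁆-self c))
    add-dominates false F c reject Cc =
      not-false⁻ (trans (≡-sym (cong (_∧ not (N[ F ] c)) Cc)) reject)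

    extend-dominates : ∀ F cs {c} → c ∈ˡ cs → C c ≡ true → N[ extend F cs ] c ≡ true
    extend-dominates F (c ∷ cs) (here refl) Cc =
      N[]-mono (extend-grows _ cs) c (add-dominates _ F c refl Cc)
    extend-dominates F (c ∷ cs) (there c∈)  Cc = extend-dominates _ cs c∈ Cc

  extend-independent : ∀ (A C : DSet n) → Independentᵇ A
    → Σ (DSet n) λ I → Independentᵇ I × I ⊑ A ∪ (C ∖ N[ A ]) × C ⊑ N[ I ]
  extend-independent A C A-indep =
    I , proj₁ inv , proj₂ (proj₂ inv) , λ c Cc → extend-dominates A (allFin n) (∈-allFin c) Cc
    where
    open Greedy A C
    I : DSet n
    I = extend A (allFin n)
    inv : Invariant I
    inv = extend-invariant A (allFin n) (A-indep , (λ _ e → e) , λ _ e → ∨-trueˡ _ e)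

theorem3 : (n : ℕ) (G : Graph n) (k : ℕ) → 1 ≤ k
    → (S : Subset n) → IsMinKkIsolating G k S → Nonempty S
    → (vs : List (Fin n)) → MinDegSeq G S vs
    → Σ (Subset n) λ I → IsIndependent G I × IsKkIsolating G k I
        × (length vs * ∣ I ∣ + ∣ S ∣ * ∣ S ∣ + length vs * length vs * maxDegree G
             ≤ length vs * ∣ S ∣ * (maxDegree G + 2))
theorem3 n G k _ S (S-isolating , _) _ vs sq = I , I-independent , I-isolating ,
  final-inequality {ℓ = length vs} {D = sum ds} {Δ = maxDegree G}
    (trans (∣∣≡count S) (count-start sq)) |I|≤ℓ+|X| |X|+Q≤DΔ D²≤ℓQ
  where
  open GraphLemmas G
  ds : List ℕ
  ds = degrees sq
  X : DSet n
  X = N[ lookup S ] ∖ N[ elements vs ]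
  extension : Σ (DSet n) λ I → Independentᵇ I × I ⊑ elements vs ∪ X × N[ lookup S ] ⊑ N[ I ]
  extension = extend-independent (elements vs) N[ lookup S ] (elements-independent sq)
  Iᵇ : DSet n
  Iᵇ = proj₁ extension
  I : Subset n
  I = tabulate Iᵇ

  I-independent : IsIndependent G I
  I-independent u w u∈ w∈ = proj₁ (proj₂ extension) u w (∈tabulate⁻ u∈) (∈tabulate⁻ w∈)

  I-isolating : IsKkIsolating G k I
  I-isolating = isolating-mono k S I
    (λ x e → N[]-mono (λ y Iy → trans (lookup∘tabulate Iᵇ y) Iy) x (proj₂ (proj₂ (proj₂ extension)) x e))
    S-isolating

  |I|≤ℓ+|X| : ∣ I ∣ ≤ length vs + count X
  |I|≤ℓ+|X| = begin
    ∣ I ∣                           ≡⟨ ∣tabulate∣ Iᵇ ⟩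
    count Iᵇ                        ≤⟨ count-mono (proj₁ (proj₂ (proj₂ extension))) ⟩
    count (elements vs ∪ X)         ≤⟨ count-∪ (elements vs) X ⟩
    count (elements vs) + count X   ≤⟨ +-monoˡ-≤ (count X) (count-elements vs) ⟩
    length vs + count X             ∎

  |X|+Q≤DΔ : count X + sum-of-squares ds ≤ sum ds * maxDegree G
  |X|+Q≤DΔ = undominated-bound sq X (λ _ e → proj₁ (∧-true⁻ e)) (λ _ e → not-true⁻ (proj₂ (∧-true⁻ e)))

  D²≤ℓQ : sum ds * sum ds ≤ length vs * sum-of-squares ds
  D²≤ℓQ = subst (λ ℓ → sum ds * sum ds ≤ ℓ * sum-of-squares ds) (length-degrees sq) (cauchy-schwarz ds)
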